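{- For every signed formula $\eta$ of the tableau system $\mathbb T$, it is possible to build a completed (open or closed) tableau for $\eta$.
   Context: Formulas of $Fm''$ are built from propositional variables using unary $\neg$ and binary $\succ$. A signed formula is $T(\alpha)$ or $F(\alpha)$ with $\alpha\in Fm''$. The rules of $\mathbb T$ (premise $\Rightarrow$ alternative conclusion sets separated by $|$) are: $T(\alpha\succ\beta)\Rightarrow \{T(\beta)\}\,|\,\{T(\neg\alpha),F(\beta),T(\neg\beta)\}\,|\,\{F(\alpha),F(\beta),F(\neg\beta)\}$; $F(\alpha\succ\beta)\Rightarrow\{T(\alpha),F(\beta),F(\neg\beta)\}\,|\,\{F(\neg\alpha),F(\beta),T(\neg\beta)\}$; $T(\neg(\alpha\succ\beta))\Rightarrow\{T(\alpha),F(\beta),T(\neg\beta)\}\,|\,\{F(\neg\alpha),T(\beta),T(\neg\beta)\}$; $F(\neg(\alpha\succ\beta))\Rightarrow\{F(\neg\beta)\}\,|\,\{T(\neg\alpha),T(\beta),T(\neg\beta)\}\,|\,\{F(\alpha),F(\beta),T(\neg\beta)\}$; $T(\neg\neg\alpha)\Rightarrow\{T(\alpha)\}$; $F(\neg\neg\alpha)\Rightarrow\{F(\alpha)\}$. A tableau for $\eta$ is a finite tree of signed formulas with root $\eta$, built by repeatedly choosing a non-closed branch and a signed formula on it that is the premise of a rule, and extending the branch at its leaf by one sub-branch per alternative conclusion set, appending the signed formulas of that set. A branch is closed if it contains $T(\gamma)$ and $F(\gamma)$ for some $\gamma$ (closure rule); a tableau is closed if all its branches are closed, open otherwise. A tableau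 is completed if on every non-closed branch every rule whose premise occurs on the branch has been applied to it along that branch. -}

module Defs where

open import Data.Nat using (ℕ)
open import Data.List using (List; []; _∷_; [_]; _++_; map)
open import Data.List.Membership.Propositional using (_∈_)
open import Data.Maybe using (Maybe; just; nothing)
open import Data.Product using (Σ; _×_; _,_; ∃-syntax)
open import Relation.Nullary using (¬_)
open import Relation.Binary.PropositionalEquality using (_≡_)
open import Relation.Binary.Construct.Closure.ReflexiveTransitive using (Star)

infixr 5 _≻_
data Fm : Set where
  var : ℕ → Fm
  ~_  : Fm → Fm
  _≻_ : Fm → Fm → Fm

data Signed : Set where
  T : Fm → Signed
  F : Fm → Signed

-- The rules of 𝕋: for a premise, the list of alternative conclusion sets
-- (each conclusion set given as the list of its signed formulas);
-- nothing if the signed formula is not the premise of any rule.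
rule : Signed → Maybe (List (List Signed))
rule (T (α ≻ β)) =
  just ( (T β ∷ [])
       ∷ (T (~ α) ∷ F β ∷ T (~ β) ∷ [])
       ∷ (F α ∷ F β ∷ F (~ β) ∷ []) ∷ [])
rule (F (α ≻ β)) =
  just ( (T α ∷ F β ∷ F (~ β) ∷ [])
       ∷ (F (~ α) ∷ F β ∷ T (~ β) ∷ []) ∷ [])
rule (T (~ (α ≻ β))) =
  just ( (T α ∷ F β ∷ T (~ β) ∷ [])
       ∷ (F (~ α) ∷ T β ∷ T (~ β) ∷ []) ∷ [])
rule (F (~ (α ≻ β))) =
  just ( (F (~ β) ∷ [])
       ∷ (T (~ α) ∷ T β ∷ T (~ β) ∷ [])
       ∷ (F α ∷ F β ∷ T (~ β) ∷ []) ∷ [])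
rule (T (~ (~ α))) = just ((T α ∷ []) ∷ [])
rule (F (~ (~ α))) = just ((F α ∷ []) ∷ [])
rule (T (~ (var _))) = nothing
rule (F (~ (var _))) = nothing
rule (T (var _)) = nothing
rule (F (var _)) = nothing

Closed : List Signed → Set
Closed fs = Σ Fm λ γ → (T γ ∈ fs) × (F γ ∈ fs)

-- Tableau trees below the root.  The root formula is kept outside.
--  * end            : the current leaf of a branch (branch not extended further)
--  * expand φ ks    : the rule with premise φ was applied at this leaf; for each
--                     alternative conclusion set cs there is a sub-branch, pairing
--                     the appended formulas cs with the rest of the tree below them.
data Cont : Set where
  end    : Cont
  expand : Signed → List (List Signed × Cont) → Cont

leaves : List (List Signed) → List (List Signed × Cont)
leaves css = map (λ cs → cs , end) css

-- One construction step: at some leaf whose branch (formulas from the root down to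
-- the leaf, `ctx`) is not closed, choose a signed formula φ on the branch which is
-- the premise of a rule, and extend the leaf by one sub-branch per conclusion set.
mutual
  data Grow (ctx : List Signed) : Cont → Cont → Set where
    here  : ∀ {φ css} → φ ∈ ctx → ¬ Closed ctx → rule φ ≡ just css →
            Grow ctx end (expand φ (leaves css))
    there : ∀ {φ ks ks'} → GrowL ctx ks ks' → Grow ctx (expand φ ks) (expand φ ks')

  data GrowL (ctx : List Signed) : List (List Signed × Cont) → List (List Signed × Cont) → Set where
    hd : ∀ {cs k k' ks} → Grow (ctx ++ cs) k k' → GrowL ctx ((cs , k) ∷ ks) ((cs , k') ∷ ks)
    tl : ∀ {p ks ks'} → GrowL ctx ks ks' → GrowL ctx (p ∷ ks) (p ∷ ks')

IsTableau : Signed → Cont → Set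
IsTableau η t = Star (Grow [ η ]) end t

-- Br ctx k fs ps : a (complete, root-to-leaf) branch through k, starting with the
-- formulas ctx above k; fs = all signed formulas on the branch, ps = the premises of
-- the rule applications performed along the branch.
data Br : List Signed → Cont → List Signed → List Signed → Set where
  leaf : ∀ {ctx} → Br ctx end ctx []
  down : ∀ {ctx φ ks cs k fs ps} → (cs , k) ∈ ks → Br (ctx ++ cs) k fs ps →
         Br ctx (expand φ ks) fs (φ ∷ ps)

Completed : Signed → Cont → Set
Completed η t = ∀ fs ps → Br [ η ] t fs ps → ¬ Closed fs →
                ∀ φ css → φ ∈ fs → rule φ ≡ just css → φ ∈ ps

-- Tableaux are grown systematically: each branch keeps a queue of the signed formulas
-- on it still to be processed; the head of the queue is expanded (if it is a premise
-- and the branch is open) and the conclusions of the chosen alternative join the queue.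
-- Each conclusion set of a rule weighs strictly less than its premise, with the weight
-- of α ≻ β exceeding that of ¬α, β, ¬β by one, so the total weight of the queue
-- decreases and bounds the depth of the construction.  On an open branch every
-- premise eventually passes through the queue, hence gets expanded: the tableau is
-- completed.
module Submission where

open import Defs
open import Data.Empty using (⊥; ⊥-elim)
open import Data.List using (List; []; _∷_; [_]; _++_; map)
open import Data.Nat.ListAction using (sum)
open import Data.Nat.ListAction.Properties using (sum-++)
open import Data.List.Properties using (map-++)
open import Data.List.Membership.Propositional using (_∈_; find; lose)
open import Data.List.Membership.Propositional.Properties using (∈-map⁻; ∈-++⁻; ∈-++⁺ˡ; ∈-++⁺ʳ)
open import Data.List.Relation.Binary.Subset.Propositional using (_⊆_)
open import Data.List.Relation.Binary.Subset.Propositional.Properties using (++⁺ˡ)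
open import Data.List.Relation.Unary.Any using (Any; here; there; any?)
open import Data.Maybe using (just; nothing)
open import Data.Nat using (ℕ; zero; suc; _+_; _≤_; _<_; s≤s; z≤n)
open import Data.Nat.Properties
  using (≤-refl; ≤-trans; ≤-pred; n≤1+n; m≤n⇒m≤1+n; m≤m+n; m≤n+m;
         +-comm; +-suc; +-assoc; +-identityʳ; +-monoʳ-≤; +-monoˡ-≤; module ≤-Reasoning)
  renaming (_≟_ to _≟ℕ_)
open import Data.Product using (Σ; _×_; _,_; uncurry)
open import Data.Sum using (_⊎_; inj₁; inj₂; [_,_]′)
open import Function using (_∘_; id)
open import Relation.Binary.Definitions using (DecidableEquality)
open import Relation.Binary.PropositionalEquality using (_≡_; refl; sym; trans; cong; cong₂; subst)
open import Relation.Binary.Construct.Closure.ReflexiveTransitive using (Star; ε; _◅_; _◅◅_; gmap)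
open import Relation.Nullary using (¬_; Dec; yes; no)
open import Relation.Nullary.Decidable using (map′; _×-dec_)

~-injective : ∀ {α β} → ~ α ≡ ~ β → α ≡ β
~-injective refl = refl

≻-injective : ∀ {α β α′ β′} → α ≻ β ≡ α′ ≻ β′ → α ≡ α′ × β ≡ β′
≻-injective refl = refl , refl

var-injective : ∀ {x y} → var x ≡ var y → x ≡ y
var-injective refl = refl

_≟_ : DecidableEquality Fm
var x   ≟ var y     = map′ (cong var) var-injective (x ≟ℕ y)
(~ α)   ≟ (~ β)     = map′ (cong ~_) ~-injective (α ≟ β)
(α ≻ β) ≟ (α′ ≻ β′) = map′ (uncurry (cong₂ _≻_)) ≻-injective (α ≟ α′ ×-dec β ≟ β′)
var _   ≟ (~ _)     = no λ ()
var _   ≟ (_ ≻ _)   = no λ ()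
(~ _)   ≟ var _     = no λ ()
(~ _)   ≟ (_ ≻ _)   = no λ ()
(_ ≻ _) ≟ var _     = no λ ()
(_ ≻ _) ≟ (~ _)     = no λ ()

T-injective : ∀ {α β} → T α ≡ T β → α ≡ β
T-injective refl = refl

F-injective : ∀ {α β} → F α ≡ F β → α ≡ β
F-injective refl = refl

_≟ˢ_ : DecidableEquality Signed
T α ≟ˢ T β = map′ (cong T) T-injective (α ≟ β)
F α ≟ˢ F β = map′ (cong F) F-injective (α ≟ β)
T _ ≟ˢ F _ = no λ ()
F _ ≟ˢ T _ = no λ ()

open import Data.List.Membership.DecPropositional _≟ˢ_ using (_∈?_)

ClashesIn : List Signed → Signed → Set
ClashesIn fs (T γ) = F γ ∈ fs
ClashesIn fs (F γ) = ⊥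

clashesIn? : ∀ fs φ → Dec (ClashesIn fs φ)
clashesIn? fs (T γ) = F γ ∈? fs
clashesIn? fs (F γ) = no λ ()

Closed⇒AnyClash : ∀ {fs} → Closed fs → Any (ClashesIn fs) fs
Closed⇒AnyClash (γ , Tγ∈fs , Fγ∈fs) = lose Tγ∈fs Fγ∈fs

AnyClash⇒Closed : ∀ {fs} → Any (ClashesIn fs) fs → Closed fs
AnyClash⇒Closed clash with find clash
... | T γ , Tγ∈fs , Fγ∈fs = γ , Tγ∈fs , Fγ∈fs

closed? : ∀ fs → Dec (Closed fs)
closed? fs = map′ AnyClash⇒Closed Closed⇒AnyClash (any? (clashesIn? fs) fs)

-- size (α ≻ β) is one more than the total size of ¬α, β, ¬β.
size : Fm → ℕ
size (var _) = 1
size (~ α)   = suc (size α)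
size (α ≻ β) = suc (suc (size α) + size β + suc (size β))

sizeˢ : Signed → ℕ
sizeˢ (T α) = size α
sizeˢ (F α) = size α

weight : List Signed → ℕ
weight = sum ∘ map sizeˢ

weight-++ : ∀ xs ys → weight (xs ++ ys) ≡ weight xs + weight ys
weight-++ xs ys = trans (cong sum (map-++ sizeˢ xs ys)) (sum-++ (map sizeˢ xs) (map sizeˢ ys))

0<size : ∀ α → 0 < size α
0<size (var _) = s≤s z≤n
0<size (~ _)   = s≤s z≤n
0<size (_ ≻ _) = s≤s z≤n

0<sizeˢ : ∀ φ → 0 < sizeˢ φ
0<sizeˢ (T α) = 0<size α
0<sizeˢ (F α) = 0<size α

-- Stated with the trailing + 0 of `weight` on a literal list.
module _ (α β : Fm) where

  private
    x = size (~ α)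
    y = size β
    z = size (~ β)

  β≤components : y + 0 ≤ x + y + z
  β≤components = subst (_≤ x + y + z) (sym (+-identityʳ y)) (≤-trans (m≤n+m y x) (m≤m+n (x + y) z))

  ¬β≤components : z + 0 ≤ x + y + z
  ¬β≤components = subst (_≤ x + y + z) (sym (+-identityʳ z)) (m≤n+m z (x + y))

  components-monoˡ : ∀ {w} → w ≤ x → w + (y + (z + 0)) ≤ x + y + z
  components-monoˡ {w} w≤x = begin
    w + (y + (z + 0)) ≡⟨ cong (λ u → w + (y + u)) (+-identityʳ z) ⟩
    w + (y + z)       ≡⟨ sym (+-assoc w y z) ⟩
    w + y + z         ≤⟨ +-monoˡ-≤ z (+-monoˡ-≤ y w≤x) ⟩
    x + y + z         ∎
    where open ≤-Reasoning

n+0<2+n : ∀ n → n + 0 < suc (suc n)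
n+0<2+n n = s≤s (subst (_≤ suc n) (sym (+-identityʳ n)) (n≤1+n n))

rule-decreases : ∀ {φ css cs} → rule φ ≡ just css → cs ∈ css → weight cs < sizeˢ φ
rule-decreases {T (α ≻ β)} refl (here refl)                 = s≤s (β≤components α β)
rule-decreases {T (α ≻ β)} refl (there (here refl))         = s≤s (components-monoˡ α β ≤-refl)
rule-decreases {T (α ≻ β)} refl (there (there (here refl))) = s≤s (components-monoˡ α β (n≤1+n _))
rule-decreases {F (α ≻ β)} refl (here refl)                 = s≤s (components-monoˡ α β (n≤1+n _))
rule-decreases {F (α ≻ β)} refl (there (here refl))         = s≤s (components-monoˡ α β ≤-refl)
rule-decreases {T (~ (α ≻ β))} refl (here refl)             = s≤s (m≤n⇒m≤1+n (components-monoˡ α β (n≤1+n _)))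
rule-decreases {T (~ (α ≻ β))} refl (there (here refl))     = s≤s (m≤n⇒m≤1+n (components-monoˡ α β ≤-refl))
rule-decreases {F (~ (α ≻ β))} refl (here refl)             = s≤s (m≤n⇒m≤1+n (¬β≤components α β))
rule-decreases {F (~ (α ≻ β))} refl (there (here refl))     = s≤s (m≤n⇒m≤1+n (components-monoˡ α β ≤-refl))
rule-decreases {F (~ (α ≻ β))} refl (there (there (here refl))) = s≤s (m≤n⇒m≤1+n (components-monoˡ α β (n≤1+n _)))
rule-decreases {T (~ (~ α))} refl (here refl) = n+0<2+n (size α)
rule-decreases {F (~ (~ α))} refl (here refl) = n+0<2+n (size α)

weight-after-expansion : ∀ {a b c n} → c < a → a + b ≤ suc n → b + c ≤ n
weight-after-expansion {a} {b} {c} {n} c<a a+b≤1+n = ≤-pred (begin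
  suc (b + c) ≡⟨ sym (+-suc b c) ⟩
  b + suc c   ≤⟨ +-monoʳ-≤ b c<a ⟩
  b + a       ≡⟨ +-comm b a ⟩
  a + b       ≤⟨ a+b≤1+n ⟩
  suc n       ∎)
  where open ≤-Reasoning

weight-after-skip : ∀ {a b n} → 0 < a → a + b ≤ suc n → b ≤ n
weight-after-skip 0<a a+b≤1+n = ≤-trans (m≤m+n _ 0) (weight-after-expansion 0<a a+b≤1+n)

-- systematic n ctx queue: the tableau grown below a leaf whose branch is ctx,
-- processing `queue` front to back; n is fuel, enough once weight queue ≤ n.
systematic : ℕ → List Signed → List Signed → Cont
systematic zero    ctx queue       = end
systematic (suc n) ctx []          = end
systematic (suc n) ctx (φ ∷ queue) with closed? ctx | rule φ
... | yes _ | _        = end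
... | no _  | nothing  = systematic n ctx queue
... | no _  | just css = expand φ (map (λ cs → cs , systematic n (ctx ++ cs) (queue ++ cs)) css)

grow-each : ∀ {ctx} (f : List Signed → Cont) → (∀ cs → Star (Grow (ctx ++ cs)) end (f cs)) →
            ∀ css → Star (GrowL ctx) (leaves css) (map (λ cs → cs , f cs) css)
grow-each f grow-f []         = ε
grow-each f grow-f (cs ∷ css) =
  gmap (λ k → (cs , k) ∷ leaves css) hd (grow-f cs) ◅◅ gmap ((cs , f cs) ∷_) tl (grow-each f grow-f css)

systematic-grows : ∀ n ctx queue → queue ⊆ ctx → Star (Grow ctx) end (systematic n ctx queue)
systematic-grows zero    ctx queue       _ = ε
systematic-grows (suc n) ctx []          _ = ε
systematic-grows (suc n) ctx (φ ∷ queue) φ∷queue⊆ctx with closed? ctx | rule φ in φ-rule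
... | yes _      | _        = ε
... | no _       | nothing  = systematic-grows n ctx queue (φ∷queue⊆ctx ∘ there)
... | no ¬closed | just css =
  here (φ∷queue⊆ctx (here refl)) ¬closed φ-rule ◅ gmap (expand φ) there (grow-each _ grow-child css)
  where
  grow-child : ∀ cs → Star (Grow (ctx ++ cs)) end (systematic n (ctx ++ cs) (queue ++ cs))
  grow-child cs = systematic-grows n (ctx ++ cs) (queue ++ cs) (++⁺ˡ cs (φ∷queue⊆ctx ∘ there))

-- Invariant for a branch fs below a node with branch ctx and queue `queue`,
-- ps being the premises expanded along fs below that node.
record Discharges (ctx queue fs ps : List Signed) : Set where
  field
    expanded-or-above : ∀ {φ css} → rule φ ≡ just css → φ ∈ fs → φ ∈ ctx ⊎ φ ∈ ps
    queue-expanded    : ∀ {φ css} → rule φ ≡ just css → φ ∈ queue → φ ∈ ps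
open Discharges

discharges-[] : ∀ {ctx ps} → Discharges ctx [] ctx ps
discharges-[] .expanded-or-above _ = inj₁
discharges-[] .queue-expanded    _ ()

discharges-skip : ∀ {ctx φ queue fs ps} → rule φ ≡ nothing →
                  Discharges ctx queue fs ps → Discharges ctx (φ ∷ queue) fs ps
discharges-skip φ-rule d .expanded-or-above = d .expanded-or-above
discharges-skip φ-rule d .queue-expanded ψ-rule (here refl) with () ← trans (sym φ-rule) ψ-rule
discharges-skip φ-rule d .queue-expanded ψ-rule (there ψ∈queue) = d .queue-expanded ψ-rule ψ∈queue

discharges-expand : ∀ {ctx φ queue cs fs ps} → Discharges (ctx ++ cs) (queue ++ cs) fs ps →
                    Discharges ctx (φ ∷ queue) fs (φ ∷ ps)
discharges-expand {ctx} {queue = queue} d .expanded-or-above ψ-rule ψ∈fs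
  with d .expanded-or-above ψ-rule ψ∈fs
... | inj₂ ψ∈ps = inj₂ (there ψ∈ps)
... | inj₁ ψ∈ctx++cs with ∈-++⁻ ctx ψ∈ctx++cs
...   | inj₁ ψ∈ctx = inj₁ ψ∈ctx
...   | inj₂ ψ∈cs  = inj₂ (there (d .queue-expanded ψ-rule (∈-++⁺ʳ queue ψ∈cs)))
discharges-expand d .queue-expanded ψ-rule (here refl)     = here refl
discharges-expand d .queue-expanded ψ-rule (there ψ∈queue) = there (d .queue-expanded ψ-rule (∈-++⁺ˡ ψ∈queue))

systematic-discharges : ∀ n ctx queue → weight queue ≤ n → ∀ {fs ps} →
                        Br ctx (systematic n ctx queue) fs ps → ¬ Closed fs → Discharges ctx queue fs ps
systematic-discharges zero    ctx []      _ leaf _ = discharges-[]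
systematic-discharges zero    ctx (φ ∷ _) w _    _ with () ← ≤-trans (0<sizeˢ φ) (≤-trans (m≤m+n _ _) w)
systematic-discharges (suc n) ctx []      _ leaf _ = discharges-[]
systematic-discharges (suc n) ctx (φ ∷ queue) w br ¬closed with closed? ctx | rule φ in φ-rule
systematic-discharges (suc n) ctx (φ ∷ queue) w leaf ¬closed | yes closed | _ = ⊥-elim (¬closed closed)
... | no _ | nothing =
  discharges-skip φ-rule (systematic-discharges n ctx queue (weight-after-skip (0<sizeˢ φ) w) br ¬closed)
systematic-discharges (suc n) ctx (φ ∷ queue) w (down child br) ¬closed | no _ | just css
  with ∈-map⁻ _ child
... | cs , cs∈css , refl =
  discharges-expand (systematic-discharges n (ctx ++ cs) (queue ++ cs) queue++cs≤n br ¬closed)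
  where
  queue++cs≤n : weight (queue ++ cs) ≤ n
  queue++cs≤n = subst (_≤ n) (sym (weight-++ queue cs))
                      (weight-after-expansion (rule-decreases φ-rule cs∈css) w)

discharges-root⇒expanded : ∀ {η fs ps} → Discharges [ η ] [ η ] fs ps →
                           ∀ φ css → φ ∈ fs → rule φ ≡ just css → φ ∈ ps
discharges-root⇒expanded d φ css φ∈fs φ-rule =
  [ d .queue-expanded φ-rule , id ]′ (d .expanded-or-above φ-rule φ∈fs)

proposition5p2 : (η : Signed) → Σ Cont λ t → IsTableau η t × Completed η t
proposition5p2 η =
    systematic n [ η ] [ η ]
  , systematic-grows n [ η ] [ η ] id
  , λ fs ps br ¬closed → discharges-root⇒expanded (systematic-discharges n [ η ] [ η ] ≤-refl br ¬closed)
  where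
  n : ℕ
  n = weight [ η ]
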